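{- Let $k\ge 4$ be an even integer and let $n\ge k$ be a multiple of $k/2$. If $d\ge k^2/2$, then there is a formula $\Psi_0\in\Phi_{n,k,d}$ such that every satisfying assignment $\sigma$ of $\Psi_0$ either has $n$ variables set to $\mathsf{TRUE}$, or has at least $2n/k$ variables set to $\mathsf{FALSE}$. Similarly, there is a formula $\Psi_1\in\Phi_{n,k,d}$ such that every satisfying assignment $\sigma$ of $\Psi_1$ either has $n$ variables set to $\mathsf{FALSE}$, or has at least $2n/k$ variables set to $\mathsf{TRUE}$.
   Context: $\Phi_{n,k,d}$ denotes the set of CNF formulas on $n$ Boolean variables in which every clause contains exactly $k$ distinct variables (each possibly negated) and every variable appears (negated or not) in at most $d$ clauses. -}

module Defs where

open import Data.Nat using (ℕ; _≤_)
open import Data.Fin using (Fin)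
open import Data.Bool using (Bool; true; false; not; _≟_)
open import Data.Product using (_×_; _,_; proj₁; proj₂)
open import Data.List using (List; length; map; filter; allFin)
open import Data.List.Relation.Unary.All using (All)
open import Data.List.Relation.Unary.Any using (Any)
open import Data.List.Relation.Unary.Unique.Propositional using (Unique)
open import Data.List.Membership.Propositional using (_∈_)
open import Data.Vec.Functional using (Vector)
open import Data.Fin.Properties using () renaming (_≟_ to _≟F_)
open import Relation.Binary.PropositionalEquality using (_≡_)
open import Relation.Nullary.Decidable using (Dec)
import Data.List.Membership.DecPropositional as DecMem

-- A literal over variables Fin n: a variable together with a sign
-- (true = positive occurrence x, false = negated occurrence ¬x).
Literal : ℕ → Set
Literal n = Fin n × Bool

var : ∀ {n} → Literal n → Fin n
var = proj₁

Clause : ℕ → Set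
Clause n = List (Literal n)

CNF : ℕ → Set
CNF n = List (Clause n)

Assignment : ℕ → Set
Assignment n = Fin n → Bool

litTrue : ∀ {n} → Assignment n → Literal n → Set
litTrue σ (x , s) = σ x ≡ s

Satisfies : ∀ {n} → Assignment n → CNF n → Set
Satisfies σ φ = All (λ C → Any (litTrue σ) C) φ

ExactlyKDistinct : ∀ {n} → ℕ → Clause n → Set
ExactlyKDistinct k C = length C ≡ k × Unique (map var C)

occurrences : ∀ {n} → CNF n → Fin n → ℕ
occurrences {n} φ x = length (filter (λ C → DecMem._∈?_ (_≟F_ {n}) x (map var C)) φ)

InΦ : (n k d : ℕ) → CNF n → Set
InΦ n k d φ = All (ExactlyKDistinct k) φ × (∀ (x : Fin n) → occurrences φ x ≤ d)

countVal : ∀ {n} → Bool → Assignment n → ℕ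
countVal {n} b σ = length (filter (λ i → σ i ≟ b) (allFin n))

-- Write k = 2h and n = mh, split the variables into m ≥ 2 blocks of size h arranged
-- in a cycle, and for each block i take the h + 1 clauses over blocks i and i − 1
-- that ask for a literal of value p among them, in one clause with all literals of
-- sign p and in the others with the sign of a single variable of block i flipped.
-- If block i − 1 has no variable of value p, these clauses force two distinct
-- variables of value p in block i. Hence every block without such a variable is
-- paid for by its successor: writing c i for the number of p-variables of block i,
-- [c i ≠ 0] + [c (i − 1) = 0] ≤ c i, and summing over the cycle gives m ≤ Σ c.
-- Each variable lies in the 2(h + 1) clauses of its own block and the next one,
-- and 2(h + 1) ≤ 2h² ≤ d.
module Submission where

open import Defs
open import Data.Nat using (ℕ; zero; suc; _+_; _*_; _/_; _≤_; z≤n; s≤s; NonZero; >-nonZero)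
open import Data.Nat.Properties
open import Data.Nat.Divisibility using (_∣_; divides)
open import Data.Nat.DivMod using (m*n/n≡m)
open import Data.Nat.Tactic.RingSolver using (solve)
open import Algebra.Properties.Semiring.Sum +-*-semiring
  using (sum; sum-syntax; ∑-distrib-+; *-distribˡ-sum; sum-cong-≗; sum-init-last; sum-remove; sum-replicate-zero)
open import Data.Fin using (Fin; zero; suc; combine; remQuot; inject₁; fromℕ; toℕ; _↑ˡ_; _↑ʳ_; punchOut)
open import Data.Fin.Properties
  using (combine-injectiveʳ; remQuot-combine; toℕ-inject₁; punchIn-punchOut)
  renaming (_≟_ to _≟ᶠ_)
open import Data.Bool using (Bool; true; false; not; if_then_else_)
open import Data.Bool.Properties using (not-¬) renaming (_≟_ to _≟ᵇ_)
open import Data.Product using (Σ; ∃; ∃₂; _×_; _,_; proj₁)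
import Data.Sum
open import Data.Sum using (_⊎_; inj₁; inj₂)
open import Data.List using (List; []; _∷_; _++_; length; map; filter; tabulate; concat)
open import Data.List.Properties using (filter-++; length-++; map-++; map-tabulate; length-tabulate)
open import Data.List.Relation.Unary.All using (All)
import Data.List.Relation.Unary.All.Properties as All
open import Data.List.Relation.Unary.Any using (Any)
import Data.List.Relation.Unary.Any.Properties as Any
open import Data.List.Relation.Unary.Unique.Propositional using (Unique)
import Data.List.Relation.Unary.Unique.Propositional.Properties as Unique
open import Data.List.Membership.Propositional using (_∈_)
open import Data.List.Membership.Propositional.Properties using (∈-++⁻; ∈-tabulate⁻)
import Data.List.Membership.DecPropositional as DecMembership
open import Data.Vec.Functional using (removeAt)
open import Function using (_∘_; id)
open import Level using (Level)
open import Relation.Binary.PropositionalEquality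
open import Relation.Nullary using (Dec; yes; no; does; ¬_; ¬?; _⊎-dec_; contradiction)
open import Relation.Nullary.Decidable using (dec-true)
open import Relation.Unary using (Pred; Decidable)

private
  variable
    a p : Level
    A : Set a
    P Q : Set p
    n : ℕ

𝟙 : Dec P → ℕ
𝟙 P? = if does P? then 1 else 0

𝟙-yes : (P? : Dec P) → P → 𝟙 P? ≡ 1
𝟙-yes P? x rewrite dec-true P? x = refl

𝟙-mono : (P → Q) → (P? : Dec P) (Q? : Dec Q) → 𝟙 P? ≤ 𝟙 Q?
𝟙-mono P⇒Q (no _)  Q? = z≤n
𝟙-mono P⇒Q (yes x) Q? = ≤-reflexive (sym (𝟙-yes Q? (P⇒Q x)))

𝟙-⊎-dec : (P? : Dec P) (Q? : Dec Q) → 𝟙 (P? ⊎-dec Q?) ≤ 𝟙 P? + 𝟙 Q?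
𝟙-⊎-dec (yes _) Q? = m≤m+n 1 (𝟙 Q?)
𝟙-⊎-dec (no _)  Q? = ≤-refl

𝟙-¬?+𝟙 : (P? : Dec P) → 𝟙 (¬? P?) + 𝟙 P? ≡ 1
𝟙-¬?+𝟙 (yes _) = refl
𝟙-¬?+𝟙 (no _)  = refl

sum-mono-≤ : {f g : Fin n → ℕ} → (∀ i → f i ≤ g i) → sum f ≤ sum g
sum-mono-≤ {zero}  f≤g = z≤n
sum-mono-≤ {suc n} f≤g = +-mono-≤ (f≤g zero) (sum-mono-≤ (f≤g ∘ suc))

sum-const : ∀ n c → ∑[ i < n ] c ≡ n * c
sum-const zero    c = refl
sum-const (suc n) c = cong (c +_) (sum-const n c)

point≤sum : (f : Fin n → ℕ) (i : Fin n) → f i ≤ sum f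
point≤sum f zero    = m≤m+n _ _
point≤sum f (suc i) = ≤-trans (point≤sum (f ∘ suc) i) (m≤n+m _ (f zero))

two-points≤sum : (f : Fin (suc n) → ℕ) {i j : Fin (suc n)} → i ≢ j → f i + f j ≤ sum f
two-points≤sum f {i} {j} i≢j = begin
  f i + f j                            ≡⟨ cong (λ k → f i + f k) (punchIn-punchOut i≢j) ⟨
  f i + removeAt f i (punchOut i≢j)    ≤⟨ +-monoʳ-≤ (f i) (point≤sum (removeAt f i) (punchOut i≢j)) ⟩
  f i + sum (removeAt f i)             ≡⟨ sum-remove f ⟨
  sum f                                ∎
  where open ≤-Reasoning

sum-↑ : ∀ m (f : Fin (m + n) → ℕ) → sum f ≡ sum (λ i → f (i ↑ˡ n)) + sum (λ j → f (m ↑ʳ j))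
sum-↑ zero    f = refl
sum-↑ (suc m) f = trans (cong (f zero +_) (sum-↑ m (f ∘ suc))) (sym (+-assoc (f zero) _ _))

sum-combine : ∀ m (f : Fin (m * n) → ℕ) → sum f ≡ ∑[ i < m ] ∑[ j < n ] f (combine i j)
sum-combine zero    f = refl
sum-combine {n} (suc m) f =
  trans (sum-↑ n f) (cong (sum (λ j → f (j ↑ˡ (m * n))) +_) (sum-combine m (λ j → f (n ↑ʳ j))))

count : {P : Pred (Fin n) p} → Decidable P → ℕ
count P? = sum (λ i → 𝟙 (P? i))

count≡0⇒¬ : {P : Pred (Fin n) p} (P? : Decidable P) → count P? ≡ 0 → ∀ i → ¬ P i
count≡0⇒¬ P? count≡0 i Pi = contradiction 1≤0 λ ()
  where
  open ≤-Reasoning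
  1≤0 : 1 ≤ 0
  1≤0 = begin
    1          ≡⟨ 𝟙-yes (P? i) Pi ⟨
    𝟙 (P? i)   ≤⟨ point≤sum (λ j → 𝟙 (P? j)) i ⟩
    count P?   ≡⟨ count≡0 ⟩
    0          ∎

two≤count : {P : Pred (Fin n) p} (P? : Decidable P) {i j : Fin n} → i ≢ j → P i → P j → 2 ≤ count P?
two≤count {n = suc n} P? {i} {j} i≢j Pi Pj = begin
  2                     ≡⟨ cong₂ _+_ (𝟙-yes (P? i) Pi) (𝟙-yes (P? j) Pj) ⟨
  𝟙 (P? i) + 𝟙 (P? j)   ≤⟨ two-points≤sum (λ k → 𝟙 (P? k)) i≢j ⟩
  count P?              ∎
  where open ≤-Reasoning

-- Both clauses compute: zero ≟ suc j is a no, and suc i ≟ suc j decides as i ≟ j.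
count-≡ : (i : Fin n) → count (i ≟ᶠ_) ≡ 1
count-≡ {suc n} zero    = cong suc (sum-replicate-zero n)
count-≡ {suc n} (suc i) = count-≡ i

length-filter-tabulate : {P : Pred A p} (P? : Decidable P) (f : Fin n → A) →
                         length (filter P? (tabulate f)) ≡ count (P? ∘ f)
length-filter-tabulate {n = zero}  P? f = refl
length-filter-tabulate {n = suc n} P? f with does (P? (f zero))
... | true  = cong suc (length-filter-tabulate P? (f ∘ suc))
... | false = length-filter-tabulate P? (f ∘ suc)

length-filter-concat : {P : Pred A p} (P? : Decidable P) (g : Fin n → List A) →
                       length (filter P? (concat (tabulate g))) ≡ ∑[ i < n ] length (filter P? (g i))
length-filter-concat {n = zero}  P? g = refl
length-filter-concat {A = A} {n = suc n} P? g = begin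
  length (filter P? (g zero ++ rest))                    ≡⟨ cong length (filter-++ P? (g zero) rest) ⟩
  length (filter P? (g zero) ++ filter P? rest)          ≡⟨ length-++ (filter P? (g zero)) ⟩
  length (filter P? (g zero)) + length (filter P? rest)  ≡⟨ cong (length (filter P? (g zero)) +_) (length-filter-concat P? (g ∘ suc)) ⟩
  ∑[ i < suc n ] length (filter P? (g i))                ∎
  where
  open ≡-Reasoning
  rest : List A
  rest = concat (tabulate (g ∘ suc))

cyclicPred : Fin (suc n) → Fin (suc n)
cyclicPred zero    = fromℕ _
cyclicPred (suc i) = inject₁ i

cyclicPred-≢ : (i : Fin (suc (suc n))) → cyclicPred i ≢ i
cyclicPred-≢ zero    ()
cyclicPred-≢ (suc i) eq = 1+n≢n (sym (trans (sym (toℕ-inject₁ i)) (cong toℕ eq)))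

sum-cyclicPred : (f : Fin (suc n) → ℕ) → sum (f ∘ cyclicPred) ≡ sum f
sum-cyclicPred f = trans (+-comm (f (fromℕ _)) _) (sym (sum-init-last f))

𝟙[a≢0]+𝟙[b≡0]≤a : ∀ a b → (b ≡ 0 → 2 ≤ a) → 𝟙 (¬? (a ≟ 0)) + 𝟙 (b ≟ 0) ≤ a
𝟙[a≢0]+𝟙[b≡0]≤a zero    zero    2≤a with () ← 2≤a refl
𝟙[a≢0]+𝟙[b≡0]≤a (suc a) zero    2≤a = 2≤a refl
𝟙[a≢0]+𝟙[b≡0]≤a zero    (suc b) _   = z≤n
𝟙[a≢0]+𝟙[b≡0]≤a (suc a) (suc b) _   = s≤s z≤n

size≤sum-if-0-followed-by-2 : (c : Fin (suc n) → ℕ) → (∀ i → c (cyclicPred i) ≡ 0 → 2 ≤ c i) →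
                              suc n ≤ sum c
size≤sum-if-0-followed-by-2 {n} c 0⇒2 = begin
  suc n                                                ≡⟨ trans (sum-const (suc n) 1) (*-identityʳ (suc n)) ⟨
  ∑[ i < suc n ] 1                                     ≡⟨ sum-cong-≗ (λ i → 𝟙-¬?+𝟙 (c i ≟ 0)) ⟨
  ∑[ i < suc n ] (positive i + isZero i)               ≡⟨ ∑-distrib-+ positive isZero ⟩
  sum positive + sum isZero                            ≡⟨ cong (sum positive +_) (sum-cyclicPred isZero) ⟨
  sum positive + sum (isZero ∘ cyclicPred)             ≡⟨ ∑-distrib-+ positive (isZero ∘ cyclicPred) ⟨
  ∑[ i < suc n ] (positive i + isZero (cyclicPred i))  ≤⟨ sum-mono-≤ (λ i → 𝟙[a≢0]+𝟙[b≡0]≤a _ _ (0⇒2 i)) ⟩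
  sum c                                                ∎
  where
  open ≤-Reasoning
  positive isZero : Fin (suc n) → ℕ
  positive i = 𝟙 (¬? (c i ≟ 0))
  isZero   i = 𝟙 (c i ≟ 0)

module CyclicBlocks (m′ h : ℕ) (p : Bool) where

  m : ℕ
  m = suc (suc m′)

  blockVar : Fin m → Fin h → Fin (m * h)
  blockVar = combine

  block : Fin (m * h) → Fin m
  block x = proj₁ (remQuot h x)

  sign : Fin (suc h) → Fin h → Bool
  sign zero    r = p
  sign (suc s) r = if does (s ≟ᶠ r) then not p else p

  clause : Fin m → Fin (suc h) → Clause (m * h)
  clause i t = tabulate (λ r → blockVar i r , sign t r) ++ tabulate (λ r → blockVar (cyclicPred i) r , p)

  Ψ : CNF (m * h)
  Ψ = concat (tabulate (λ i → tabulate (clause i)))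

  ∈-tabulate-blockVar⇒block : ∀ {x} i → x ∈ tabulate (blockVar i) → block x ≡ i
  ∈-tabulate-blockVar⇒block i x∈ =
    let r , x≡ir = ∈-tabulate⁻ x∈ in trans (cong block x≡ir) (cong proj₁ (remQuot-combine i r))

  clauseVars : Fin m → List (Fin (m * h))
  clauseVars i = tabulate (blockVar i) ++ tabulate (blockVar (cyclicPred i))

  map-var-clause : ∀ i t → map var (clause i t) ≡ clauseVars i
  map-var-clause i t = trans (map-++ var (tabulate (λ r → blockVar i r , sign t r)) _)
    (cong₂ _++_ (map-tabulate (λ r → blockVar i r , sign t r) var)
                (map-tabulate (λ r → blockVar (cyclicPred i) r , p) var))

  clauseVars-unique : ∀ i → Unique (clauseVars i)
  clauseVars-unique i = Unique.++⁺ (Unique.tabulate⁺ (combine-injectiveʳ i _ i _))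
                                   (Unique.tabulate⁺ (combine-injectiveʳ (cyclicPred i) _ (cyclicPred i) _))
                                   disjoint
    where
    disjoint : ∀ {x} → ¬ (x ∈ tabulate (blockVar i) × x ∈ tabulate (blockVar (cyclicPred i)))
    disjoint (x∈i , x∈i-1) =
      cyclicPred-≢ i (trans (sym (∈-tabulate-blockVar⇒block (cyclicPred i) x∈i-1))
                            (∈-tabulate-blockVar⇒block i x∈i))

  length-clause : ∀ i t → length (clause i t) ≡ h + h
  length-clause i t = trans (length-++ (tabulate (λ r → blockVar i r , sign t r)))
    (cong₂ _+_ (length-tabulate (λ r → blockVar i r , sign t r))
               (length-tabulate (λ r → blockVar (cyclicPred i) r , p)))

  Ψ-exactly-k : All (ExactlyKDistinct (h + h)) Ψ
  Ψ-exactly-k = All.concat⁺ (All.tabulate⁺ λ i → All.tabulate⁺ λ t →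
    length-clause i t , subst Unique (sym (map-var-clause i t)) (clauseVars-unique i))

  ∈-clauseVars⇒block : ∀ {x} i → x ∈ clauseVars i → block x ≡ i ⊎ block x ≡ cyclicPred i
  ∈-clauseVars⇒block i x∈ with ∈-++⁻ (tabulate (blockVar i)) x∈
  ... | inj₁ x∈i   = inj₁ (∈-tabulate-blockVar⇒block i x∈i)
  ... | inj₂ x∈i-1 = inj₂ (∈-tabulate-blockVar⇒block (cyclicPred i) x∈i-1)

  occurrences-Ψ : ∀ x → occurrences Ψ x ≤ suc h * 2
  occurrences-Ψ x = begin
    occurrences Ψ x
      ≡⟨ length-filter-concat contains-x? (λ i → tabulate (clause i)) ⟩
    ∑[ i < m ] length (filter contains-x? (tabulate (clause i)))
      ≡⟨ sum-cong-≗ (λ i → length-filter-tabulate contains-x? (clause i)) ⟩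
    ∑[ i < m ] ∑[ t < suc h ] 𝟙 (x ∈? map var (clause i t))
      ≡⟨ sum-cong-≗ (λ i → sum-cong-≗ λ t → cong (𝟙 ∘ (x ∈?_)) (map-var-clause i t)) ⟩
    ∑[ i < m ] ∑[ t < suc h ] 𝟙 (x ∈? clauseVars i)
      ≡⟨ sum-cong-≗ (λ i → sum-const (suc h) (𝟙 (x ∈? clauseVars i))) ⟩
    ∑[ i < m ] (suc h * 𝟙 (x ∈? clauseVars i))
      ≡⟨ *-distribˡ-sum (suc h) (λ i → 𝟙 (x ∈? clauseVars i)) ⟨
    suc h * ∑[ i < m ] 𝟙 (x ∈? clauseVars i)
      ≤⟨ *-monoʳ-≤ (suc h) in-at-most-two-blocks ⟩
    suc h * 2 ∎
    where
    open ≤-Reasoning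
    open DecMembership (_≟ᶠ_ {m * h}) using (_∈?_)
    contains-x? : (C : Clause (m * h)) → Dec (x ∈ map var C)
    contains-x? C = x ∈? map var C
    b : Fin m
    b = block x
    in-block : ∀ i → Dec (b ≡ i ⊎ b ≡ cyclicPred i)
    in-block i = (b ≟ᶠ i) ⊎-dec (b ≟ᶠ cyclicPred i)
    in-at-most-two-blocks : ∑[ i < m ] 𝟙 (x ∈? clauseVars i) ≤ 2
    in-at-most-two-blocks = begin
      ∑[ i < m ] 𝟙 (x ∈? clauseVars i)
        ≤⟨ sum-mono-≤ (λ i → ≤-trans (𝟙-mono (∈-clauseVars⇒block i) (x ∈? clauseVars i) (in-block i))
                                      (𝟙-⊎-dec (b ≟ᶠ i) (b ≟ᶠ cyclicPred i))) ⟩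
      ∑[ i < m ] (𝟙 (b ≟ᶠ i) + 𝟙 (b ≟ᶠ cyclicPred i))
        ≡⟨ ∑-distrib-+ (λ i → 𝟙 (b ≟ᶠ i)) (λ i → 𝟙 (b ≟ᶠ cyclicPred i)) ⟩
      count (b ≟ᶠ_) + sum (λ i → 𝟙 (b ≟ᶠ cyclicPred i))
        ≡⟨ cong₂ _+_ (count-≡ b) (trans (sum-cyclicPred (λ i → 𝟙 (b ≟ᶠ i))) (count-≡ b)) ⟩
      2 ∎

  module _ (σ : Assignment (m * h)) where

    is-p? : ∀ i → Decidable (λ r → σ (blockVar i r) ≡ p)
    is-p? i r = σ (blockVar i r) ≟ᵇ p

    blockCount : Fin m → ℕ
    blockCount i = count (is-p? i)

    countVal≡sum-blockCount : countVal p σ ≡ sum blockCount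
    countVal≡sum-blockCount =
      trans (length-filter-tabulate (λ x → σ x ≟ᵇ p) id) (sum-combine {n = h} m (λ x → 𝟙 (σ x ≟ᵇ p)))

    satisfied⇒witness : Satisfies σ Ψ → ∀ i t →
      (∃ λ r → σ (blockVar i r) ≡ sign t r) ⊎ (∃ λ r → σ (blockVar (cyclicPred i) r) ≡ p)
    satisfied⇒witness σ⊨Ψ i t = Data.Sum.map Any.tabulate⁻ Any.tabulate⁻ (Any.++⁻ _
      (All.tabulate⁻ {f = clause i} (All.tabulate⁻ {f = tabulate ∘ clause} (All.concat⁻ σ⊨Ψ) i) t))

    empty-predecessor⇒two : Satisfies σ Ψ → ∀ i → blockCount (cyclicPred i) ≡ 0 → 2 ≤ blockCount i
    empty-predecessor⇒two σ⊨Ψ i empty with satisfied⇒witness σ⊨Ψ i zero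
    ... | inj₂ (r , σr≡p) = contradiction σr≡p (count≡0⇒¬ (is-p? (cyclicPred i)) empty r)
    ... | inj₁ (r₀ , σr₀≡p) with satisfied⇒witness σ⊨Ψ i (suc r₀)
    ...   | inj₂ (r , σr≡p) = contradiction σr≡p (count≡0⇒¬ (is-p? (cyclicPred i)) empty r)
    -- Abstracting r₀ ≟ r also in the type of σr≡sign evaluates sign (suc r₀) r.
    ...   | inj₁ (r , σr≡sign) with r₀ ≟ᶠ r | σr≡sign
    ...     | yes refl | σr₀≡¬p = contradiction (trans (sym σr₀≡p) σr₀≡¬p) (not-¬ refl)
    ...     | no r₀≢r  | σr≡p   = two≤count (is-p? i) r₀≢r σr₀≡p σr≡p

    satisfied⇒m≤countVal : Satisfies σ Ψ → m ≤ countVal p σ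
    satisfied⇒m≤countVal σ⊨Ψ = subst (m ≤_) (sym countVal≡sum-blockCount)
      (size≤sum-if-0-followed-by-2 blockCount (empty-predecessor⇒two σ⊨Ψ))

cyclic-block-formula : ∀ m h d (p : Bool) → 2 ≤ m → suc h * 2 ≤ d →
  Σ (CNF (m * h)) λ Ψ → InΦ (m * h) (h + h) d Ψ × (∀ σ → Satisfies σ Ψ → m ≤ countVal p σ)
cyclic-block-formula (suc (suc m′)) h d p (s≤s (s≤s z≤n)) 2[h+1]≤d =
  Ψ , (Ψ-exactly-k , λ x → ≤-trans (occurrences-Ψ x) 2[h+1]≤d) , satisfied⇒m≤countVal
  where open CyclicBlocks m′ h p

suc-n≤n*n : 2 ≤ n → suc n ≤ n * n
suc-n≤n*n {n} 2≤n = begin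
  1 + n      ≤⟨ +-monoˡ-≤ n (≤-trans (s≤s z≤n) 2≤n) ⟩
  n + n      ≡⟨ cong (n +_) (+-identityʳ n) ⟨
  2 * n      ≤⟨ *-monoˡ-≤ n 2≤n ⟩
  n * n      ∎
  where open ≤-Reasoning

blocks-of-half-size : ∀ {k n d} → 4 ≤ k → 2 ∣ k → k ≤ n → (k / 2) ∣ n → k * k ≤ 2 * d →
  ∃₂ λ m h → k ≡ h + h × n ≡ m * h × 2 ≤ m × suc h * 2 ≤ d
blocks-of-half-size {n = n} {d} 4≤k (divides h refl) k≤n (divides m n≡m*[k/2]) k*k≤2d =
  m , h , h*2≡h+h , n≡m*h , 2≤m , *-cancelˡ-≤ 2 (≤-trans 2*[suc-h*2]≤k*k k*k≤2d)
  where
  open ≤-Reasoning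
  h*2≡h+h : h * 2 ≡ h + h
  h*2≡h+h = solve (h ∷ [])
  n≡m*h : n ≡ m * h
  n≡m*h = trans n≡m*[k/2] (cong (m *_) (m*n/n≡m h 2))
  2≤h : 2 ≤ h
  2≤h = *-cancelʳ-≤ 2 h 2 4≤k
  instance
    h-nonZero : NonZero h
    h-nonZero = >-nonZero (≤-trans (s≤s z≤n) 2≤h)
  2≤m : 2 ≤ m
  2≤m = *-cancelʳ-≤ 2 m h (begin 2 * h ≡⟨ *-comm 2 h ⟩ h * 2 ≤⟨ k≤n ⟩ _ ≡⟨ n≡m*h ⟩ m * h ∎)
  2*[suc-h*2]≤k*k : 2 * (suc h * 2) ≤ h * 2 * (h * 2)
  2*[suc-h*2]≤k*k = begin
    2 * (suc h * 2)   ≤⟨ *-monoʳ-≤ 2 (*-monoˡ-≤ 2 (suc-n≤n*n 2≤h)) ⟩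
    2 * (h * h * 2)   ≡⟨ solve (h ∷ []) ⟩
    h * 2 * (h * 2)   ∎

lemma3p1 : (k n d : ℕ) → 4 ≤ k → 2 ∣ k → k ≤ n → (k / 2) ∣ n → k * k ≤ 2 * d
    → (Σ (CNF n) λ Ψ₀ → InΦ n k d Ψ₀ × (∀ (σ : Assignment n) → Satisfies σ Ψ₀ → countVal true σ ≡ n ⊎ 2 * n ≤ k * countVal false σ))
    × (Σ (CNF n) λ Ψ₁ → InΦ n k d Ψ₁ × (∀ (σ : Assignment n) → Satisfies σ Ψ₁ → countVal false σ ≡ n ⊎ 2 * n ≤ k * countVal true σ))
lemma3p1 k n d 4≤k 2∣k k≤n [k/2]∣n k*k≤2d with blocks-of-half-size {n = n} {d} 4≤k 2∣k k≤n [k/2]∣n k*k≤2d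
... | m , h , refl , refl , 2≤m , 2[h+1]≤d = formula false , formula true
  where
  formula : ∀ p → Σ (CNF (m * h)) λ Ψ → InΦ (m * h) (h + h) d Ψ ×
              (∀ σ → Satisfies σ Ψ → countVal (not p) σ ≡ m * h ⊎ 2 * (m * h) ≤ (h + h) * countVal p σ)
  formula p with Ψ , Ψ∈Φ , m≤count ← cyclic-block-formula m h d p 2≤m 2[h+1]≤d =
    Ψ , Ψ∈Φ , λ σ σ⊨Ψ → inj₂ (begin
      2 * (m * h)          ≡⟨ solve (m ∷ h ∷ []) ⟩
      (h + h) * m          ≤⟨ *-monoʳ-≤ (h + h) (m≤count σ σ⊨Ψ) ⟩
      (h + h) * countVal p σ ∎)
    where open ≤-Reasoning
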